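{- Let $r\geq 3$ be an integer and let $G$ be a connected $r$-regular graph that has no perfect matching. If $\alpha(G)=\mu(G)$, then (i) $A_G\subseteq I$ for every maximum independent set $I$ of $G$; and (ii) $C_G=\emptyset$.
   Context: All graphs are finite, undirected and loopless. $\alpha(G)$ is the independence number and $\mu(G)$ the matching number of $G$. Canonical (Gallai–Edmonds) decomposition: $D_G$ is the set of vertices of $G$ that are left unsaturated by at least one maximum matching of $G$; $A_G$ is the set of vertices in $V(G)\setminus D_G$ adjacent to at least one vertex of $D_G$; $C_G=V(G)\setminus(D_G\cup A_G)$. -}

module Defs where

open import Data.Nat using (ℕ; zero; suc; _+_; _*_; _≤_)
open import Data.Bool using (Bool; true; false)
open import Data.Fin using (Fin)
open import Data.Fin.Subset using (Subset; _∈_; _∉_; ∣_∣)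
open import Data.Vec using (tabulate)
open import Data.Maybe using (Maybe; just; nothing; is-just)
open import Data.Product using (Σ; ∃; _×_)
open import Relation.Binary.PropositionalEquality using (_≡_)
open import Relation.Nullary using (¬_)

record Graph (n : ℕ) : Set where
  field
    adj    : Fin n → Fin n → Bool
    sym    : ∀ u v → adj u v ≡ adj v u
    irrefl : ∀ v → adj v v ≡ false
open Graph public

module _ {n : ℕ} (G : Graph n) where

  Adj : Fin n → Fin n → Set
  Adj u v = adj G u v ≡ true

  nbhd : Fin n → Subset n
  nbhd v = tabulate (adj G v)

  degree : Fin n → ℕ
  degree v = ∣ nbhd v ∣

  Regular : ℕ → Set
  Regular r = ∀ v → degree v ≡ r

  data Walk : Fin n → Fin n → Set where
    here : ∀ {v} → Walk v v
    step : ∀ {u v w} → Adj u v → Walk v w → Walk u w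

  Connected : Set
  Connected = ∀ u v → Walk u v

  Independent : Subset n → Set
  Independent I = ∀ u v → u ∈ I → v ∈ I → ¬ Adj u v

  MaximumIndependent : Subset n → Set
  MaximumIndependent I = Independent I × (∀ J → Independent J → ∣ J ∣ ≤ ∣ I ∣)

  IndependenceNumber : ℕ → Set
  IndependenceNumber k = Σ (Subset n) λ I → MaximumIndependent I × ∣ I ∣ ≡ k

  -- A matching, given by its partner function: M v = just w means vw ∈ M,
  -- M v = nothing means v is unsaturated.
  IsMatching : (Fin n → Maybe (Fin n)) → Set
  IsMatching M = ∀ u v → M u ≡ just v → Adj u v × M v ≡ just u

  Matching : Set
  Matching = Σ (Fin n → Maybe (Fin n)) IsMatching

  saturated : Matching → Subset n
  saturated (M Data.Product., _) = tabulate (λ v → is-just (M v))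

  -- number of edges of M is (number of saturated vertices) / 2
  MatchingSize : Matching → ℕ → Set
  MatchingSize M k = ∣ saturated M ∣ ≡ 2 * k

  MaximumMatching : Matching → Set
  MaximumMatching M = ∀ M′ → ∣ saturated M′ ∣ ≤ ∣ saturated M ∣

  MatchingNumber : ℕ → Set
  MatchingNumber k = Σ Matching λ M → MaximumMatching M × MatchingSize M k

  PerfectMatching : Matching → Set
  PerfectMatching (M Data.Product., _) = ∀ v → ¬ (M v ≡ nothing)

  HasPerfectMatching : Set
  HasPerfectMatching = Σ Matching PerfectMatching

  -- Gallai–Edmonds decomposition
  InD : Fin n → Set
  InD v = Σ Matching λ M → MaximumMatching M × Data.Product.proj₁ M v ≡ nothing

  InA : Fin n → Set
  InA v = ¬ InD v × ∃ λ w → InD w × Adj v w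

  InC : Fin n → Set
  InC v = ¬ InD v × ¬ InA v

module Submission where

-- Let I be an independent set with |I| = μ(G) and w ∉ I.  The heart of the proof is that
-- then w ∈ D_G: by Hall's theorem I can be matched into V ∖ {w}, and such a matching has
-- μ(G) edges and misses w.  Hall's condition for S ⊆ I comes from double counting the r|S|
-- edges at S.  If some vertex of Γ(S) has a neighbour outside S, then |Γ(S)| > |S|, which
-- pays for the loss of w.  Otherwise S ∪ Γ(S) is closed under adjacency, hence all of V by
-- connectedness, and |Γ(S)| ≤ |S| gives |V| ≤ 2|S| ≤ 2μ(G): a perfect matching.
-- Then (i): a vertex of A_G is not in D_G, so it lies in every maximum independent set; and
-- (ii): a vertex v of C_G is not in D_G, so v ∈ I, its neighbours are outside I, hence in
-- D_G, and v ∈ A_G.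

open import Defs hiding (sym)
open import Data.Bool using (Bool; true; false; _∧_) renaming (_≟_ to _≟ᵇ_)
open import Data.Fin using (Fin; zero; suc; _≟_)
open import Data.Fin.Properties using (any?)
open import Data.Fin.Subset
open import Data.Fin.Subset.Properties
open import Data.Maybe using (Maybe; just; nothing; is-just)
open import Data.Nat using (ℕ; zero; suc; _+_; _*_; _≤_; _<_; z≤n; s≤s; z<s; NonZero)
open import Data.Nat.Induction using (<-wellFounded)
open import Data.Nat.Properties
  using ( _≤?_; ≤-reflexive; ≤-trans; ≤-antisym; ≤-pred; <-irrefl; <-≤-trans; ≰⇒>; module ≤-Reasoning
        ; +-comm; +-suc; +-identityʳ; m≤m+n; +-mono-≤; +-monoˡ-≤; +-monoʳ-≤; +-mono-<-≤; +-mono-≤-<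
        ; +-cancelˡ-≤; *-monoʳ-≤; *-cancelʳ-≤; *-cancelʳ-<; +-0-commutativeMonoid; +-*-semiring )
open import Algebra.Properties.CommutativeMonoid.Sum +-0-commutativeMonoid
  using (sum-syntax; ∑-comm; sum-cong-≗; sum-replicate-zero)
open import Algebra.Properties.Semiring.Sum +-*-semiring using (*-distribʳ-sum)
open import Data.Product using (Σ; ∃; _×_; _,_; proj₁; proj₂)
open import Data.Sum using (_⊎_; inj₁; inj₂)
open import Data.Vec using (_∷_; []; lookup; tabulate; there)
open import Data.Vec.Properties using (lookup∘tabulate; lookup⇒[]=; []=⇒lookup; lookup-zipWith)
open import Function using (_∘_)
open import Induction.WellFounded using (Acc; acc)
open import Level using (Level)
open import Relation.Binary using (REL; Decidable)
open import Relation.Binary.PropositionalEquality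
  using (_≡_; _≢_; refl; sym; trans; cong; subst; module ≡-Reasoning)
open import Relation.Nullary using (¬_; Dec; yes; no; does; ¬?; contradiction)
open import Relation.Nullary.Decidable using (_×-dec_; dec-true)

private
  variable
    n m : ℕ
    ℓ : Level

⟦_⟧ : Bool → ℕ
⟦ true ⟧ = 1
⟦ false ⟧ = 0

∣p∣≡∑⟦p⟧ : (p : Subset n) → ∣ p ∣ ≡ ∑[ x < n ] ⟦ lookup p x ⟧
∣p∣≡∑⟦p⟧ [] = refl
∣p∣≡∑⟦p⟧ (inside ∷ p) = cong suc (∣p∣≡∑⟦p⟧ p)
∣p∣≡∑⟦p⟧ (outside ∷ p) = ∣p∣≡∑⟦p⟧ p

∣p∣*a≡∑⟦p⟧*a : (p : Subset n) (a : ℕ) → ∣ p ∣ * a ≡ ∑[ x < n ] (⟦ lookup p x ⟧ * a)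
∣p∣*a≡∑⟦p⟧*a p a = trans (cong (_* a) (∣p∣≡∑⟦p⟧ p)) (*-distribʳ-sum a (λ x → ⟦ lookup p x ⟧))

∣tabulate∣≡∑ : (f : Fin n → Bool) → ∣ tabulate f ∣ ≡ ∑[ x < n ] ⟦ f x ⟧
∣tabulate∣≡∑ f = trans (∣p∣≡∑⟦p⟧ (tabulate f)) (sum-cong-≗ (cong ⟦_⟧ ∘ lookup∘tabulate f))

∑-mono-≤ : {f g : Fin n → ℕ} → (∀ x → f x ≤ g x) → ∑[ x < n ] f x ≤ ∑[ x < n ] g x
∑-mono-≤ {zero} f≤g = z≤n
∑-mono-≤ {suc n} f≤g = +-mono-≤ (f≤g zero) (∑-mono-≤ (f≤g ∘ suc))

∑-mono-< : {f g : Fin n → ℕ} → (∀ x → f x ≤ g x) → ∀ y → f y < g y →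
           ∑[ x < n ] f x < ∑[ x < n ] g x
∑-mono-< f≤g zero fy<gy = +-mono-<-≤ fy<gy (∑-mono-≤ (f≤g ∘ suc))
∑-mono-< f≤g (suc y) fy<gy = +-mono-≤-< (f≤g zero) (∑-mono-< (f≤g ∘ suc) y fy<gy)

∑⟦b∧f⟧≡⟦b⟧*∑⟦f⟧ : ∀ b (f : Fin n → Bool) →
                  ∑[ x < n ] ⟦ b ∧ f x ⟧ ≡ ⟦ b ⟧ * ∑[ x < n ] ⟦ f x ⟧
∑⟦b∧f⟧≡⟦b⟧*∑⟦f⟧ true f = sym (+-identityʳ _)
∑⟦b∧f⟧≡⟦b⟧*∑⟦f⟧ {n} false f = sum-replicate-zero n

⟦∈⟧ : {p : Subset n} {x : Fin n} → x ∈ p → ⟦ lookup p x ⟧ ≡ 1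
⟦∈⟧ x∈p = cong ⟦_⟧ ([]=⇒lookup x∈p)

⟦∉⟧ : {p : Subset n} {x : Fin n} → x ∉ p → ⟦ lookup p x ⟧ ≡ 0
⟦∉⟧ {p = p} {x} x∉p with lookup p x in eq
... | true = contradiction (lookup⇒[]= x p eq) x∉p
... | false = refl

∣p∪q∣+∣p∩q∣≡∣p∣+∣q∣ : (p q : Subset n) → ∣ p ∪ q ∣ + ∣ p ∩ q ∣ ≡ ∣ p ∣ + ∣ q ∣
∣p∪q∣+∣p∩q∣≡∣p∣+∣q∣ [] [] = refl
∣p∪q∣+∣p∩q∣≡∣p∣+∣q∣ (inside ∷ p) (inside ∷ q) =
  cong suc (trans (+-suc _ _) (trans (cong suc (∣p∪q∣+∣p∩q∣≡∣p∣+∣q∣ p q)) (sym (+-suc _ _))))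
∣p∪q∣+∣p∩q∣≡∣p∣+∣q∣ (inside ∷ p) (outside ∷ q) =
  cong suc (∣p∪q∣+∣p∩q∣≡∣p∣+∣q∣ p q)
∣p∪q∣+∣p∩q∣≡∣p∣+∣q∣ (outside ∷ p) (inside ∷ q) =
  trans (cong suc (∣p∪q∣+∣p∩q∣≡∣p∣+∣q∣ p q)) (sym (+-suc _ _))
∣p∪q∣+∣p∩q∣≡∣p∣+∣q∣ (outside ∷ p) (outside ∷ q) = ∣p∪q∣+∣p∩q∣≡∣p∣+∣q∣ p q

∣p∪q∣≤∣p∣+∣q∣ : (p q : Subset n) → ∣ p ∪ q ∣ ≤ ∣ p ∣ + ∣ q ∣
∣p∪q∣≤∣p∣+∣q∣ p q = ≤-trans (m≤m+n _ _) (≤-reflexive (∣p∪q∣+∣p∩q∣≡∣p∣+∣q∣ p q))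

Empty⇒∣p∣≡0 : {p : Subset n} → Empty p → ∣ p ∣ ≡ 0
Empty⇒∣p∣≡0 {n} ∅ = trans (cong ∣_∣ (Empty-unique ∅)) (∣⊥∣≡0 n)

∣p∪q∣≡∣p∣+∣q∣ : (p q : Subset n) → Empty (p ∩ q) → ∣ p ∪ q ∣ ≡ ∣ p ∣ + ∣ q ∣
∣p∪q∣≡∣p∣+∣q∣ p q ∅ = begin
  ∣ p ∪ q ∣               ≡⟨ +-identityʳ _ ⟨
  ∣ p ∪ q ∣ + 0           ≡⟨ cong (∣ p ∪ q ∣ +_) (Empty⇒∣p∣≡0 ∅) ⟨
  ∣ p ∪ q ∣ + ∣ p ∩ q ∣   ≡⟨ ∣p∪q∣+∣p∩q∣≡∣p∣+∣q∣ p q ⟩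
  ∣ p ∣ + ∣ q ∣           ∎
  where open ≡-Reasoning

∣p∣≤1+∣p-x∣ : (p : Subset n) (x : Fin n) → ∣ p ∣ ≤ suc ∣ p - x ∣
∣p∣≤1+∣p-x∣ p x = begin
  ∣ p ∣                    ≤⟨ p⊆q⇒∣p∣≤∣q∣ p⊆p-x∪x ⟩
  ∣ (p - x) ∪ ⁅ x ⁆ ∣       ≤⟨ ∣p∪q∣≤∣p∣+∣q∣ (p - x) ⁅ x ⁆ ⟩
  ∣ p - x ∣ + ∣ ⁅ x ⁆ ∣     ≡⟨ cong (∣ p - x ∣ +_) (∣⁅x⁆∣≡1 x) ⟩
  ∣ p - x ∣ + 1            ≡⟨ +-comm _ 1 ⟩
  suc ∣ p - x ∣            ∎
  where
  open ≤-Reasoning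
  p⊆p-x∪x : p ⊆ (p - x) ∪ ⁅ x ⁆
  p⊆p-x∪x {y} y∈p with y ≟ x
  ... | yes refl = x∈p∪q⁺ (inj₂ (x∈⁅x⁆ x))
  ... | no y≢x = x∈p∪q⁺ (inj₁ (x∈p∧x≢y⇒x∈p-y y∈p y≢x))

x∈p─q⇒x∉q : {x : Fin n} (p q : Subset n) → x ∈ p ─ q → x ∉ q
x∈p─q⇒x∉q (_ ∷ p) (outside ∷ q) (there x∈p─q) (there x∈q) = x∈p─q⇒x∉q p q x∈p─q x∈q
x∈p─q⇒x∉q (_ ∷ p) (inside ∷ q) (there x∈p─q) (there x∈q) = x∈p─q⇒x∉q p q x∈p─q x∈q

∈-tabulate⁺ : {f : Fin n → Bool} {x : Fin n} → f x ≡ true → x ∈ tabulate f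
∈-tabulate⁺ {f = f} {x} fx = lookup⇒[]= x (tabulate f) (trans (lookup∘tabulate f x) fx)

∈-tabulate⁻ : {f : Fin n → Bool} {x : Fin n} → x ∈ tabulate f → f x ≡ true
∈-tabulate⁻ {f = f} {x} x∈ = trans (sym (lookup∘tabulate f x)) ([]=⇒lookup x∈)

subset : {P : Fin n → Set ℓ} → (∀ x → Dec (P x)) → Subset n
subset P? = tabulate (does ∘ P?)

∈-subset⁺ : {P : Fin n → Set ℓ} (P? : ∀ x → Dec (P x)) {x : Fin n} → P x → x ∈ subset P?
∈-subset⁺ P? {x} px = ∈-tabulate⁺ (dec-true (P? x) px)

∈-subset⁻ : {P : Fin n → Set ℓ} (P? : ∀ x → Dec (P x)) {x : Fin n} → x ∈ subset P? → P x
∈-subset⁻ P? {x} x∈ with P? x | ∈-tabulate⁻ {f = does ∘ P?} x∈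
... | yes px | _ = px

Avoiding : REL (Fin n) (Fin m) ℓ → Subset m → REL (Fin n) (Fin m) ℓ
Avoiding R Z x y = R x y × y ∉ Z

avoiding? : {R : REL (Fin n) (Fin m) ℓ} → Decidable R → (Z : Subset m) → Decidable (Avoiding R Z)
avoiding? R? Z x y = R? x y ×-dec ¬? (y ∈? Z)

module _ {R : REL (Fin n) (Fin m) ℓ} (R? : Decidable R) where

  Γ? : (S : Subset n) (y : Fin m) → Dec (∃ λ x → x ∈ S × R x y)
  Γ? S y = any? (λ x → x ∈? S ×-dec R? x y)

  Γ : Subset n → Subset m
  Γ S = subset (Γ? S)

  ∈-Γ⁺ : {S : Subset n} {x : Fin n} {y : Fin m} → x ∈ S → R x y → y ∈ Γ S
  ∈-Γ⁺ {S} x∈S xRy = ∈-subset⁺ (Γ? S) (_ , x∈S , xRy)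

  ∈-Γ⁻ : {S : Subset n} {y : Fin m} → y ∈ Γ S → ∃ λ x → x ∈ S × R x y
  ∈-Γ⁻ {S} = ∈-subset⁻ (Γ? S)

-- pick is defined on X only: for empty X there may be no function Fin n → Fin m at all.
record Transversal (R : REL (Fin n) (Fin m) ℓ) (X : Subset n) : Set ℓ where
  field
    pick     : ∀ {x} → x ∈ X → Fin m
    pick-rel : ∀ {x} (x∈X : x ∈ X) → R x (pick x∈X)
    pick-inj : ∀ {x y} (x∈X : x ∈ X) (y∈X : y ∈ X) → pick x∈X ≡ pick y∈X → x ≡ y

HallCondition : {R : REL (Fin n) (Fin m) ℓ} → Decidable R → Subset n → Set
HallCondition R? X = ∀ S → S ⊆ X → ∣ S ∣ ≤ ∣ Γ R? S ∣

transversal-∅ : {R : REL (Fin n) (Fin m) ℓ} {X : Subset n} → Empty X → Transversal R X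
transversal-∅ X-empty = record
  { pick     = λ x∈X → contradiction (_ , x∈X) X-empty
  ; pick-rel = λ x∈X → contradiction (_ , x∈X) X-empty
  ; pick-inj = λ x∈X _ _ → contradiction (_ , x∈X) X-empty
  }

module _ {R : REL (Fin n) (Fin m) ℓ} (R? : Decidable R) where

  Γ-─⊆ : (S : Subset n) (Z : Subset m) → Γ R? S ─ Z ⊆ Γ (avoiding? R? Z) S
  Γ-─⊆ S Z {y} y∈ with ∈-Γ⁻ R? (p─q⊆p (Γ R? S) Z y∈)
  ... | x , x∈S , xRy = ∈-Γ⁺ (avoiding? R? Z) x∈S (xRy , x∈p─q⇒x∉q (Γ R? S) Z y∈)

  Γ-∪⊆ : (S T : Subset n) → Γ R? (S ∪ T) ⊆ Γ R? S ∪ Γ (avoiding? R? (Γ R? S)) T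
  Γ-∪⊆ S T {y} y∈ with y ∈? Γ R? S | ∈-Γ⁻ R? y∈
  ... | yes y∈ΓS | _ = x∈p∪q⁺ (inj₁ y∈ΓS)
  ... | no y∉ΓS | x , x∈S∪T , xRy with x∈p∪q⁻ S T x∈S∪T
  ...   | inj₁ x∈S = contradiction (∈-Γ⁺ R? x∈S xRy) y∉ΓS
  ...   | inj₂ x∈T = x∈p∪q⁺ (inj₂ (Γ-─⊆ T (Γ R? S) (x∈p∧x∉q⇒x∈p─q (∈-Γ⁺ R? x∈T xRy) y∉ΓS)))

  transversal-∪ : {X : Subset n} (S : Subset n) → Transversal R S →
                  Transversal (Avoiding R (Γ R? S)) (X ─ S) → Transversal R X
  transversal-∪ {X} S T₁ T₂ = record
    { pick     = λ x∈X → pickᵈ x∈X (_ ∈? S)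
    ; pick-rel = λ x∈X → pick-relᵈ x∈X (_ ∈? S)
    ; pick-inj = λ x∈X y∈X → pick-injᵈ x∈X y∈X (_ ∈? S) (_ ∈? S)
    }
    where
    module T₁ = Transversal T₁
    module T₂ = Transversal T₂

    pickᵈ : ∀ {x} → x ∈ X → Dec (x ∈ S) → Fin m
    pickᵈ x∈X (yes x∈S) = T₁.pick x∈S
    pickᵈ x∈X (no x∉S) = T₂.pick (x∈p∧x∉q⇒x∈p─q x∈X x∉S)

    pick-relᵈ : ∀ {x} (x∈X : x ∈ X) (x∈?S : Dec (x ∈ S)) → R x (pickᵈ x∈X x∈?S)
    pick-relᵈ x∈X (yes x∈S) = T₁.pick-rel x∈S
    pick-relᵈ x∈X (no x∉S) = proj₁ (T₂.pick-rel (x∈p∧x∉q⇒x∈p─q x∈X x∉S))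

    separated : ∀ {x y} (x∈S : x ∈ S) (y∈X─S : y ∈ X ─ S) → T₁.pick x∈S ≢ T₂.pick y∈X─S
    separated x∈S y∈X─S eq =
      proj₂ (T₂.pick-rel y∈X─S) (subst (_∈ Γ R? S) eq (∈-Γ⁺ R? x∈S (T₁.pick-rel x∈S)))

    pick-injᵈ : ∀ {x y} (x∈X : x ∈ X) (y∈X : y ∈ X) (x∈?S : Dec (x ∈ S)) (y∈?S : Dec (y ∈ S)) →
                pickᵈ x∈X x∈?S ≡ pickᵈ y∈X y∈?S → x ≡ y
    pick-injᵈ _ _ (yes x∈S) (yes y∈S) = T₁.pick-inj x∈S y∈S
    pick-injᵈ _ _ (no x∉S) (no y∉S) = T₂.pick-inj _ _
    pick-injᵈ _ _ (yes x∈S) (no y∉S) eq = contradiction eq (separated x∈S _)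
    pick-injᵈ _ _ (no x∉S) (yes y∈S) eq = contradiction (sym eq) (separated y∈S _)

  transversal-insert : {X : Subset n} {x : Fin n} {y : Fin m} → x ∈ X → R x y →
                       Transversal (Avoiding R ⁅ y ⁆) (X - x) → Transversal R X
  transversal-insert {X} {x} {y} x∈X xRy T = record
    { pick     = λ z∈X → pickᵈ z∈X (_ ≟ x)
    ; pick-rel = λ z∈X → pick-relᵈ z∈X (_ ≟ x)
    ; pick-inj = λ z∈X z′∈X → pick-injᵈ z∈X z′∈X (_ ≟ x) (_ ≟ x)
    }
    where
    module T = Transversal T

    pickᵈ : ∀ {z} → z ∈ X → Dec (z ≡ x) → Fin m
    pickᵈ z∈X (yes _) = y
    pickᵈ z∈X (no z≢x) = T.pick (x∈p∧x≢y⇒x∈p-y z∈X z≢x)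

    pick-relᵈ : ∀ {z} (z∈X : z ∈ X) (z≟x : Dec (z ≡ x)) → R z (pickᵈ z∈X z≟x)
    pick-relᵈ z∈X (yes refl) = xRy
    pick-relᵈ z∈X (no z≢x) = proj₁ (T.pick-rel (x∈p∧x≢y⇒x∈p-y z∈X z≢x))

    y-unused : ∀ {z} (z∈X-x : z ∈ X - x) → y ≢ T.pick z∈X-x
    y-unused z∈X-x eq = proj₂ (T.pick-rel z∈X-x) (subst (_∈ ⁅ y ⁆) eq (x∈⁅x⁆ y))

    pick-injᵈ : ∀ {z z′} (z∈X : z ∈ X) (z′∈X : z′ ∈ X) (z≟x : Dec (z ≡ x)) (z′≟x : Dec (z′ ≡ x)) →
                pickᵈ z∈X z≟x ≡ pickᵈ z′∈X z′≟x → z ≡ z′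
    pick-injᵈ _ _ (yes z≡x) (yes z′≡x) _ = trans z≡x (sym z′≡x)
    pick-injᵈ _ _ (no _) (no _) = T.pick-inj _ _
    pick-injᵈ _ _ (yes _) (no _) eq = contradiction eq (y-unused _)
    pick-injᵈ _ _ (no _) (yes _) eq = contradiction (sym eq) (y-unused _)

  tight⇒hall-─ : {X : Subset n} → HallCondition R? X → (S : Subset n) → S ⊆ X → ∣ Γ R? S ∣ ≤ ∣ S ∣ →
                 HallCondition (avoiding? R? (Γ R? S)) (X ─ S)
  tight⇒hall-─ {X} hallX S S⊆X ∣ΓS∣≤∣S∣ T T⊆X─S = +-cancelˡ-≤ ∣ S ∣ _ _ (begin
    ∣ S ∣ + ∣ T ∣                ≡⟨ ∣p∪q∣≡∣p∣+∣q∣ S T S∩T-empty ⟨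
    ∣ S ∪ T ∣                    ≤⟨ hallX (S ∪ T) S∪T⊆X ⟩
    ∣ Γ R? (S ∪ T) ∣             ≤⟨ p⊆q⇒∣p∣≤∣q∣ (Γ-∪⊆ S T) ⟩
    ∣ Γ R? S ∪ Γ R?′ T ∣          ≤⟨ ∣p∪q∣≤∣p∣+∣q∣ (Γ R? S) (Γ R?′ T) ⟩
    ∣ Γ R? S ∣ + ∣ Γ R?′ T ∣      ≤⟨ +-monoˡ-≤ _ ∣ΓS∣≤∣S∣ ⟩
    ∣ S ∣ + ∣ Γ R?′ T ∣           ∎)
    where
    open ≤-Reasoning
    R?′ : Decidable (Avoiding R (Γ R? S))
    R?′ = avoiding? R? (Γ R? S)
    S∩T-empty : Empty (S ∩ T)
    S∩T-empty (x , x∈S∩T) with x∈p∩q⁻ S T x∈S∩T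
    ... | x∈S , x∈T = x∈p─q⇒x∉q X S (T⊆X─S x∈T) x∈S
    S∪T⊆X : S ∪ T ⊆ X
    S∪T⊆X x∈S∪T with x∈p∪q⁻ S T x∈S∪T
    ... | inj₁ x∈S = S⊆X x∈S
    ... | inj₂ x∈T = p─q⊆p X S (T⊆X─S x∈T)

  loose⇒hall-- : {X : Subset n} {x : Fin n} → HallCondition R? X →
                 (∀ T → T ⊂ X → Nonempty T → ∣ T ∣ < ∣ Γ R? T ∣) → x ∈ X → (y : Fin m) →
                 HallCondition (avoiding? R? ⁅ y ⁆) (X - x)
  loose⇒hall-- {X} {x} hallX loose x∈X y T T⊆X-x with nonempty? T
  ... | no T-empty = ≤-trans (≤-reflexive (Empty⇒∣p∣≡0 T-empty)) z≤n
  ... | yes T-nonempty = ≤-pred (begin-strict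
    ∣ T ∣                         <⟨ loose T T⊂X T-nonempty ⟩
    ∣ Γ R? T ∣                    ≤⟨ ∣p∣≤1+∣p-x∣ (Γ R? T) y ⟩
    suc ∣ Γ R? T - y ∣             ≤⟨ s≤s (p⊆q⇒∣p∣≤∣q∣ (Γ-─⊆ T ⁅ y ⁆)) ⟩
    suc ∣ Γ (avoiding? R? ⁅ y ⁆) T ∣ ∎)
    where
    open ≤-Reasoning
    T⊂X : T ⊂ X
    T⊂X = p─q⊆p X ⁅ x ⁆ ∘ T⊆X-x , x , x∈X , λ x∈T → x∈p─q⇒x∉q X ⁅ x ⁆ (T⊆X-x x∈T) (x∈⁅x⁆ x)

  hall⇒related : {X : Subset n} {x : Fin n} → HallCondition R? X → x ∈ X → ∃ λ y → R x y
  hall⇒related {X} {x} hallX x∈X with nonempty? (Γ R? ⁅ x ⁆)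
  ... | yes (y , y∈Γx) with ∈-Γ⁻ R? y∈Γx
  ...   | x′ , x′∈⁅x⁆ , x′Ry = y , subst (λ z → R z y) (x∈⁅y⁆⇒x≡y x x′∈⁅x⁆) x′Ry
  hall⇒related {X} {x} hallX x∈X | no Γx-empty = contradiction (begin-strict
    0                   <⟨ z<s ⟩
    1                   ≡⟨ ∣⁅x⁆∣≡1 x ⟨
    ∣ ⁅ x ⁆ ∣            ≤⟨ hallX ⁅ x ⁆ ⁅x⁆⊆X ⟩
    ∣ Γ R? ⁅ x ⁆ ∣       ≡⟨ Empty⇒∣p∣≡0 Γx-empty ⟩
    0                   ∎) (<-irrefl refl)
    where
    open ≤-Reasoning
    ⁅x⁆⊆X : ⁅ x ⁆ ⊆ X
    ⁅x⁆⊆X y∈⁅x⁆ = subst (_∈ X) (sym (x∈⁅y⁆⇒x≡y x y∈⁅x⁆)) x∈X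

hall : {R : REL (Fin n) (Fin m) ℓ} (R? : Decidable R) (X : Subset n) → HallCondition R? X → Transversal R X
hall {n} {m} {ℓ} R? X = go R? X (<-wellFounded ∣ X ∣)
  where
  go : {R : REL (Fin n) (Fin m) ℓ} (R? : Decidable R) (X : Subset n) →
       Acc _<_ ∣ X ∣ → HallCondition R? X → Transversal R X
  -- Either a proper nonempty S ⊂ X is tight, and S and X ─ S are matched separately,
  -- or every such S has a surplus, and any x ∈ X may be matched to any neighbour y.
  go R? X (acc rec) hallX with anySubset? (λ S → S ⊂? X ×-dec nonempty? S ×-dec ∣ Γ R? S ∣ ≤? ∣ S ∣)
  ... | yes (S , S⊂X@(S⊆X , _) , (s , s∈S) , ∣ΓS∣≤∣S∣) = transversal-∪ R? S
    (go R? S (rec (p⊂q⇒∣p∣<∣q∣ S⊂X)) (λ T T⊆S → hallX T (S⊆X ∘ T⊆S)))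
    (go (avoiding? R? (Γ R? S)) (X ─ S) (rec (p∩q≢∅⇒∣p─q∣<∣p∣ X S (s , x∈p∩q⁺ (S⊆X s∈S , s∈S))))
      (tight⇒hall-─ R? hallX S S⊆X ∣ΓS∣≤∣S∣))
  ... | no no-tight-set with nonempty? X
  ...   | no X-empty = transversal-∅ X-empty
  ...   | yes (x , x∈X) with hall⇒related R? hallX x∈X
  ...     | y , xRy = transversal-insert R? x∈X xRy
    (go (avoiding? R? ⁅ y ⁆) (X - x) (rec (x∈p⇒∣p-x∣<∣p∣ x∈X)) (loose⇒hall-- R? hallX loose x∈X y))
    where
    loose : ∀ T → T ⊂ X → Nonempty T → ∣ T ∣ < ∣ Γ R? T ∣
    loose T T⊂X T-nonempty = ≰⇒> λ ∣ΓT∣≤∣T∣ → no-tight-set (T , T⊂X , T-nonempty , ∣ΓT∣≤∣T∣)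

graph? : (f : Fin n → Fin m) → Decidable (λ x y → f x ≡ y)
graph? f x y = f x ≟ y

image : (Fin n → Fin m) → Subset n → Subset m
image f = Γ (graph? f)

∣X∣≤∣image∣ : (f : Fin n → Fin m) (X : Subset n) → (∀ {x y} → x ∈ X → y ∈ X → f x ≡ f y → x ≡ y) →
              ∣ X ∣ ≤ ∣ image f X ∣
∣X∣≤∣image∣ {n} f X = go X (<-wellFounded ∣ X ∣)
  where
  go : (X : Subset n) → Acc _<_ ∣ X ∣ → (∀ {x y} → x ∈ X → y ∈ X → f x ≡ f y → x ≡ y) →
       ∣ X ∣ ≤ ∣ image f X ∣
  go X (acc rec) f-inj with nonempty? X
  ... | no X-empty = ≤-trans (≤-reflexive (Empty⇒∣p∣≡0 X-empty)) z≤n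
  ... | yes (x , x∈X) = begin
    ∣ X ∣                     ≤⟨ ∣p∣≤1+∣p-x∣ X x ⟩
    suc ∣ X - x ∣              ≤⟨ s≤s (go (X - x) (rec (x∈p⇒∣p-x∣<∣p∣ x∈X)) (λ y∈ → f-inj (X-x⊆X y∈) ∘ X-x⊆X)) ⟩
    suc ∣ image f (X - x) ∣    ≤⟨ s≤s (p⊆q⇒∣p∣≤∣q∣ image[X-x]⊆image[X]-fx) ⟩
    suc ∣ image f X - f x ∣    ≤⟨ x∈p⇒∣p-x∣<∣p∣ (∈-Γ⁺ (graph? f) x∈X refl) ⟩
    ∣ image f X ∣              ∎
    where
    open ≤-Reasoning
    X-x⊆X : X - x ⊆ X
    X-x⊆X = p─q⊆p X ⁅ x ⁆
    image[X-x]⊆image[X]-fx : image f (X - x) ⊆ image f X - f x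
    image[X-x]⊆image[X]-fx y∈ with ∈-Γ⁻ (graph? f) y∈
    ... | z , z∈X-x , refl = x∈p∧x≢y⇒x∈p-y (∈-Γ⁺ (graph? f) (X-x⊆X z∈X-x) refl) λ fz≡fx →
      x∈p─q⇒x∉q X ⁅ x ⁆ z∈X-x (subst (_∈ ⁅ x ⁆) (sym (f-inj (X-x⊆X z∈X-x) x∈X fz≡fx)) (x∈⁅x⁆ x))

module _ (G : Graph n) where

  adj? : Decidable (Adj G)
  adj? u v = adj G u v ≟ᵇ true

  Adj-sym : ∀ {u v} → Adj G u v → Adj G v u
  Adj-sym {u} {v} uv = trans (Graph.sym G v u) uv

  closed-connected : Connected G → (C : Subset n) → (∀ {u v} → u ∈ C → Adj G u v → v ∈ C) →
                     ∀ {u} → u ∈ C → ∀ v → v ∈ C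
  closed-connected conn C closed {u} u∈C v = along (conn u v) u∈C
    where
    along : ∀ {x y} → Walk G x y → x ∈ C → y ∈ C
    along here x∈C = x∈C
    along (step xz walk) x∈C = along walk (closed x∈C xz)

  ∣saturated∣≥n⇒perfect : (M : Matching G) → n ≤ ∣ saturated G M ∣ → PerfectMatching G M
  ∣saturated∣≥n⇒perfect M@(mate , _) n≤∣M∣ v mate-v≡nothing =
    contradiction (trans (cong is-just (sym mate-v≡nothing)) v-saturated) λ ()
    where
    v-saturated : is-just (mate v) ≡ true
    v-saturated = ∈-tabulate⁻ (subst (v ∈_) (sym M-full) ∈⊤)
      where
      M-full : saturated G M ≡ ⊤
      M-full = ∣p∣≡n⇒p≡⊤ (≤-antisym (∣p∣≤n (saturated G M)) n≤∣M∣)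

module _ (G : Graph n) {r : ℕ} (reg : Regular G r) where

  ∑∣S∩nbhd∣≡∣S∣*r : (S : Subset n) → ∑[ y < n ] ∣ S ∩ nbhd G y ∣ ≡ ∣ S ∣ * r
  ∑∣S∩nbhd∣≡∣S∣*r S = begin
    ∑[ y < n ] ∣ S ∩ nbhd G y ∣                       ≡⟨ sum-cong-≗ column ⟩
    ∑[ y < n ] ∑[ x < n ] ⟦ lookup S x ∧ adj G x y ⟧  ≡⟨ ∑-comm (λ x y → ⟦ lookup S x ∧ adj G x y ⟧) ⟨
    ∑[ x < n ] ∑[ y < n ] ⟦ lookup S x ∧ adj G x y ⟧  ≡⟨ sum-cong-≗ row ⟩
    ∑[ x < n ] (⟦ lookup S x ⟧ * r)                   ≡⟨ ∣p∣*a≡∑⟦p⟧*a S r ⟨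
    ∣ S ∣ * r                                         ∎
    where
    open ≡-Reasoning
    column : ∀ y → ∣ S ∩ nbhd G y ∣ ≡ ∑[ x < n ] ⟦ lookup S x ∧ adj G x y ⟧
    column y = trans (∣p∣≡∑⟦p⟧ (S ∩ nbhd G y)) (sum-cong-≗ λ x →
      cong ⟦_⟧ (trans (lookup-zipWith _∧_ x S (nbhd G y))
                      (cong (lookup S x ∧_) (trans (lookup∘tabulate (adj G y) x) (Graph.sym G y x)))))
    row : ∀ x → ∑[ y < n ] ⟦ lookup S x ∧ adj G x y ⟧ ≡ ⟦ lookup S x ⟧ * r
    row x = trans (∑⟦b∧f⟧≡⟦b⟧*∑⟦f⟧ (lookup S x) (adj G x))
                  (cong (⟦ lookup S x ⟧ *_) (trans (sym (∣tabulate∣≡∑ (adj G x))) (reg x)))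

  column-≤ : (S : Subset n) (y : Fin n) → ∣ S ∩ nbhd G y ∣ ≤ ⟦ lookup (Γ (adj? G) S) y ⟧ * r
  column-≤ S y with y ∈? Γ (adj? G) S
  ... | yes y∈ΓS rewrite ⟦∈⟧ y∈ΓS | +-identityʳ r = ≤-trans (∣p∩q∣≤∣q∣ S (nbhd G y)) (≤-reflexive (reg y))
  ... | no y∉ΓS rewrite ⟦∉⟧ y∉ΓS = ≤-reflexive (Empty⇒∣p∣≡0 λ (x , x∈S∩Ny) →
        let x∈S , x∈Ny = x∈p∩q⁻ S (nbhd G y) x∈S∩Ny
        in  y∉ΓS (∈-Γ⁺ (adj? G) x∈S (Adj-sym G (∈-tabulate⁻ x∈Ny))))

  column-< : {S : Subset n} {x y : Fin n} → y ∈ Γ (adj? G) S → Adj G y x → x ∉ S →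
             ∣ S ∩ nbhd G y ∣ < ⟦ lookup (Γ (adj? G) S) y ⟧ * r
  column-< {S} {x} {y} y∈ΓS yx x∉S rewrite ⟦∈⟧ y∈ΓS | +-identityʳ r =
    <-≤-trans (p⊂q⇒∣p∣<∣q∣ (p∩q⊆q S (nbhd G y) , x , ∈-tabulate⁺ yx ,
                             x∉S ∘ proj₁ ∘ x∈p∩q⁻ S (nbhd G y)))
              (≤-reflexive (reg y))

  column-≥ : {S : Subset n} (y : Fin n) → (∀ {x} → y ∈ Γ (adj? G) S → Adj G y x → x ∈ S) →
             ⟦ lookup (Γ (adj? G) S) y ⟧ * r ≤ ∣ S ∩ nbhd G y ∣
  column-≥ {S} y Ny⊆S with y ∈? Γ (adj? G) S
  ... | yes y∈ΓS rewrite ⟦∈⟧ y∈ΓS | +-identityʳ r =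
        ≤-trans (≤-reflexive (sym (reg y)))
                (p⊆q⇒∣p∣≤∣q∣ λ x∈Ny → x∈p∩q⁺ (Ny⊆S y∈ΓS (∈-tabulate⁻ x∈Ny) , x∈Ny))
  ... | no y∉ΓS rewrite ⟦∉⟧ y∉ΓS = z≤n

  module _ .{{_ : NonZero r}} (S : Subset n) where

    leaking⇒∣S∣<∣ΓS∣ : {x y : Fin n} → y ∈ Γ (adj? G) S → Adj G y x → x ∉ S → ∣ S ∣ < ∣ Γ (adj? G) S ∣
    leaking⇒∣S∣<∣ΓS∣ {x} {y} y∈ΓS yx x∉S = *-cancelʳ-< r ∣ S ∣ ∣ Γ (adj? G) S ∣ (begin-strict
      ∣ S ∣ * r                                         ≡⟨ ∑∣S∩nbhd∣≡∣S∣*r S ⟨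
      ∑[ z < n ] ∣ S ∩ nbhd G z ∣                      <⟨ ∑-mono-< (column-≤ S) y (column-< y∈ΓS yx x∉S) ⟩
      ∑[ z < n ] (⟦ lookup (Γ (adj? G) S) z ⟧ * r)     ≡⟨ ∣p∣*a≡∑⟦p⟧*a (Γ (adj? G) S) r ⟨
      ∣ Γ (adj? G) S ∣ * r                              ∎)
      where open ≤-Reasoning

    closed⇒∣ΓS∣≤∣S∣ : (∀ {x y} → y ∈ Γ (adj? G) S → Adj G y x → x ∈ S) → ∣ Γ (adj? G) S ∣ ≤ ∣ S ∣
    closed⇒∣ΓS∣≤∣S∣ closed = *-cancelʳ-≤ ∣ Γ (adj? G) S ∣ ∣ S ∣ r (begin
      ∣ Γ (adj? G) S ∣ * r                              ≡⟨ ∣p∣*a≡∑⟦p⟧*a (Γ (adj? G) S) r ⟩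
      ∑[ z < n ] (⟦ lookup (Γ (adj? G) S) z ⟧ * r)     ≤⟨ ∑-mono-≤ (λ z → column-≥ z closed) ⟩
      ∑[ z < n ] ∣ S ∩ nbhd G z ∣                      ≡⟨ ∑∣S∩nbhd∣≡∣S∣*r S ⟩
      ∣ S ∣ * r                                         ∎)
      where open ≤-Reasoning

module _ (G : Graph n) {I : Subset n} (I-indep : Independent G I) {w : Fin n}
         (T : Transversal (Avoiding (Adj G) ⁅ w ⁆) I) where

  open Transversal T

  -- Outside I the value of partner is an arbitrary placeholder.
  partner : Fin n → Fin n
  partner u with u ∈? I
  ... | yes u∈I = pick u∈I
  ... | no _ = u

  partner-rel : ∀ {u} → u ∈ I → Avoiding (Adj G) ⁅ w ⁆ u (partner u)
  partner-rel {u} u∈I with u ∈? I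
  ... | yes u∈I′ = pick-rel u∈I′
  ... | no u∉I = contradiction u∈I u∉I

  partner-inj : ∀ {u v} → u ∈ I → v ∈ I → partner u ≡ partner v → u ≡ v
  partner-inj {u} {v} u∈I v∈I with u ∈? I | v ∈? I
  ... | yes u∈I′ | yes v∈I′ = pick-inj u∈I′ v∈I′
  ... | no u∉I | _ = contradiction u∈I u∉I
  ... | _ | no v∉I = contradiction v∈I v∉I

  partner∉I : ∀ {u} → u ∈ I → partner u ∉ I
  partner∉I u∈I pu∈I = I-indep _ _ u∈I pu∈I (proj₁ (partner-rel u∈I))

  mate : Fin n → Maybe (Fin n)
  mate v with v ∈? I | Γ? (graph? partner) I v
  ... | yes v∈I | _ = just (pick v∈I)
  ... | no _ | yes (u , _) = just u
  ... | no _ | no _ = nothing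

  mate-∈ : ∀ {v} → v ∈ I → mate v ≡ just (partner v)
  mate-∈ {v} v∈I with v ∈? I | Γ? (graph? partner) I v
  ... | yes _ | _ = refl
  ... | no v∉I | _ = contradiction v∈I v∉I

  mate-partner : ∀ {u} → u ∈ I → mate (partner u) ≡ just u
  mate-partner {u} u∈I with partner u ∈? I | Γ? (graph? partner) I (partner u)
  ... | yes pu∈I | _ = contradiction pu∈I (partner∉I u∈I)
  ... | no _ | yes (u′ , u′∈I , pu′≡pu) = cong just (partner-inj u′∈I u∈I pu′≡pu)
  ... | no _ | no no-preimage = contradiction (u , u∈I , refl) no-preimage

  mate-just : ∀ {u v} → mate u ≡ just v → (u ∈ I × partner u ≡ v) ⊎ (v ∈ I × partner v ≡ u)
  mate-just {u} eq with u ∈? I | Γ? (graph? partner) I u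
  mate-just refl | yes u∈I | _ = inj₁ (u∈I , refl)
  mate-just refl | no _ | yes (u′ , u′∈I , pu′≡u) = inj₂ (u′∈I , pu′≡u)

  mate-w : w ∉ I → mate w ≡ nothing
  mate-w w∉I with w ∈? I | Γ? (graph? partner) I w
  ... | yes w∈I | _ = contradiction w∈I w∉I
  ... | no _ | yes (u , u∈I , pu≡w) =
    contradiction (subst (_∈ ⁅ w ⁆) (sym pu≡w) (x∈⁅x⁆ w)) (proj₂ (partner-rel u∈I))
  ... | no _ | no _ = refl

  mate-matching : IsMatching G mate
  mate-matching u v eq with mate-just eq
  ... | inj₁ (u∈I , refl) = proj₁ (partner-rel u∈I) , mate-partner u∈I
  ... | inj₂ (v∈I , refl) = Adj-sym G (proj₁ (partner-rel v∈I)) , mate-∈ v∈I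

  matching : Matching G
  matching = mate , mate-matching

  2∣I∣≤∣matching∣ : 2 * ∣ I ∣ ≤ ∣ saturated G matching ∣
  2∣I∣≤∣matching∣ = begin
    2 * ∣ I ∣                  ≡⟨ cong (∣ I ∣ +_) (+-identityʳ ∣ I ∣) ⟩
    ∣ I ∣ + ∣ I ∣               ≤⟨ +-monoʳ-≤ ∣ I ∣ (∣X∣≤∣image∣ partner I partner-inj) ⟩
    ∣ I ∣ + ∣ J ∣               ≡⟨ ∣p∪q∣≡∣p∣+∣q∣ I J I∩J-empty ⟨
    ∣ I ∪ J ∣                  ≤⟨ p⊆q⇒∣p∣≤∣q∣ I∪J⊆saturated ⟩
    ∣ saturated G matching ∣ ∎
    where
    open ≤-Reasoning
    J : Subset n
    J = image partner I
    I∩J-empty : Empty (I ∩ J)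
    I∩J-empty (v , v∈I∩J) with x∈p∩q⁻ I J v∈I∩J
    ... | v∈I , v∈J with ∈-Γ⁻ (graph? partner) v∈J
    ...   | u , u∈I , refl = partner∉I u∈I v∈I
    I∪J⊆saturated : I ∪ J ⊆ saturated G matching
    I∪J⊆saturated v∈I∪J with x∈p∪q⁻ I J v∈I∪J
    ... | inj₁ v∈I = ∈-tabulate⁺ (cong is-just (mate-∈ v∈I))
    ... | inj₂ v∈J with ∈-Γ⁻ (graph? partner) v∈J
    ...   | u , u∈I , refl = ∈-tabulate⁺ (cong is-just (mate-partner u∈I))

module _ (G : Graph n) {r : ℕ} .{{_ : NonZero r}} (reg : Regular G r) (conn : Connected G)
         (no-pm : ¬ HasPerfectMatching G) where

  hall-avoiding-vertex : (M : Matching G) (w : Fin n) (S : Subset n) → 2 * ∣ S ∣ ≤ ∣ saturated G M ∣ →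
                         ∣ S ∣ ≤ ∣ Γ (avoiding? (adj? G) ⁅ w ⁆) S ∣
  hall-avoiding-vertex M w S 2∣S∣≤∣M∣
    with nonempty? S | any? (λ y → y ∈? Γ (adj? G) S ×-dec any? (λ x → adj? G y x ×-dec ¬? (x ∈? S)))
  ... | no S-empty | _ = ≤-trans (≤-reflexive (Empty⇒∣p∣≡0 S-empty)) z≤n
  ... | yes _ | yes (y , y∈ΓS , x , yx , x∉S) = ≤-pred (begin-strict
    ∣ S ∣                                    <⟨ leaking⇒∣S∣<∣ΓS∣ G reg S y∈ΓS yx x∉S ⟩
    ∣ Γ (adj? G) S ∣                         ≤⟨ ∣p∣≤1+∣p-x∣ (Γ (adj? G) S) w ⟩
    suc ∣ Γ (adj? G) S - w ∣                  ≤⟨ s≤s (p⊆q⇒∣p∣≤∣q∣ (Γ-─⊆ (adj? G) S ⁅ w ⁆)) ⟩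
    suc ∣ Γ (avoiding? (adj? G) ⁅ w ⁆) S ∣    ∎)
    where open ≤-Reasoning
  ... | yes (s , s∈S) | no no-leak = contradiction (M , ∣saturated∣≥n⇒perfect G M (begin
    n                                 ≡⟨ ∣⊤∣≡n n ⟨
    ∣ ⊤ {n} ∣                          ≤⟨ p⊆q⇒∣p∣≤∣q∣ {p = ⊤} (λ {v} _ → everything v) ⟩
    ∣ S ∪ ΓS ∣                         ≤⟨ ∣p∪q∣≤∣p∣+∣q∣ S ΓS ⟩
    ∣ S ∣ + ∣ ΓS ∣                      ≤⟨ +-monoʳ-≤ ∣ S ∣ (closed⇒∣ΓS∣≤∣S∣ G reg S ΓS-closed) ⟩
    ∣ S ∣ + ∣ S ∣                       ≡⟨ cong (∣ S ∣ +_) (+-identityʳ ∣ S ∣) ⟨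
    2 * ∣ S ∣                          ≤⟨ 2∣S∣≤∣M∣ ⟩
    ∣ saturated G M ∣                  ∎)) no-pm
    where
    open ≤-Reasoning
    ΓS : Subset n
    ΓS = Γ (adj? G) S
    ΓS-closed : ∀ {x y} → y ∈ ΓS → Adj G y x → x ∈ S
    ΓS-closed {x} {y} y∈ΓS yx with x ∈? S
    ... | yes x∈S = x∈S
    ... | no x∉S = contradiction (y , y∈ΓS , x , yx , x∉S) no-leak
    S∪ΓS-closed : ∀ {u v} → u ∈ S ∪ ΓS → Adj G u v → v ∈ S ∪ ΓS
    S∪ΓS-closed u∈ uv with x∈p∪q⁻ S ΓS u∈
    ... | inj₁ u∈S = x∈p∪q⁺ (inj₂ (∈-Γ⁺ (adj? G) u∈S uv))
    ... | inj₂ u∈ΓS = x∈p∪q⁺ (inj₁ (ΓS-closed u∈ΓS uv))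
    everything : ∀ v → v ∈ S ∪ ΓS
    everything = closed-connected G conn (S ∪ ΓS) S∪ΓS-closed (x∈p∪q⁺ (inj₁ s∈S))

  ∉I⇒InD : (M : Matching G) → MaximumMatching G M → (I : Subset n) → Independent G I →
           MatchingSize G M ∣ I ∣ → ∀ {w} → w ∉ I → InD G w
  ∉I⇒InD M M-max I I-indep ∣M∣≡2∣I∣ {w} w∉I =
    matching G I-indep T , maximum , mate-w G I-indep T w∉I
    where
    T : Transversal (Avoiding (Adj G) ⁅ w ⁆) I
    T = hall (avoiding? (adj? G) ⁅ w ⁆) I λ S S⊆I →
          hall-avoiding-vertex M w S (≤-trans (*-monoʳ-≤ 2 (p⊆q⇒∣p∣≤∣q∣ S⊆I))
                                              (≤-reflexive (sym ∣M∣≡2∣I∣)))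
    maximum : MaximumMatching G (matching G I-indep T)
    maximum M′ = ≤-trans (M-max M′) (≤-trans (≤-reflexive ∣M∣≡2∣I∣) (2∣I∣≤∣matching∣ G I-indep T))

lemma7 : (n r : ℕ) (G : Graph n) → 3 ≤ r → Regular G r → Connected G →
         ¬ HasPerfectMatching G →
         Σ ℕ (λ k → IndependenceNumber G k × MatchingNumber G k) →
         ((I : Subset n) → MaximumIndependent G I → ∀ v → InA G v → v ∈ I)
         × (∀ v → ¬ InC G v)
lemma7 n r G (s≤s _) reg conn no-pm (k , (I₀ , (I₀-indep , I₀-max) , ∣I₀∣≡k) , (M , M-max , ∣M∣≡2k)) =
  A⊆I , C-empty
  where
  ∉I⇒D : (I : Subset n) → Independent G I → ∣ I ∣ ≡ k → ∀ {w} → w ∉ I → InD G w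
  ∉I⇒D I I-indep ∣I∣≡k =
    ∉I⇒InD G reg conn no-pm M M-max I I-indep (subst (MatchingSize G M) (sym ∣I∣≡k) ∣M∣≡2k)

  A⊆I : (I : Subset n) → MaximumIndependent G I → ∀ v → InA G v → v ∈ I
  A⊆I I (I-indep , I-max) v (v∉D , _) with v ∈? I
  ... | yes v∈I = v∈I
  ... | no v∉I = contradiction (∉I⇒D I I-indep ∣I∣≡k v∉I) v∉D
    where
    ∣I∣≡k : ∣ I ∣ ≡ k
    ∣I∣≡k = ≤-antisym (subst (∣ I ∣ ≤_) ∣I₀∣≡k (I₀-max I I-indep))
                      (subst (_≤ ∣ I ∣) ∣I₀∣≡k (I-max I₀ I₀-indep))

  C-empty : ∀ v → ¬ InC G v
  C-empty v (v∉D , v∉A) with v ∈? I₀ | nonempty? (nbhd G v)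
  ... | no v∉I₀ | _ = v∉D (∉I⇒D I₀ I₀-indep ∣I₀∣≡k v∉I₀)
  ... | yes _ | no Nv-empty = contradiction (trans (sym (reg v)) (Empty⇒∣p∣≡0 Nv-empty)) λ ()
  ... | yes v∈I₀ | yes (u , u∈Nv) = v∉A (v∉D , u , ∉I⇒D I₀ I₀-indep ∣I₀∣≡k u∉I₀ , vu)
    where
    vu : Adj G v u
    vu = ∈-tabulate⁻ u∈Nv
    u∉I₀ : u ∉ I₀
    u∉I₀ u∈I₀ = I₀-indep v u v∈I₀ u∈I₀ vu
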